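{- For every (finite, simple, connected) graph $G$ with $n\geq 3$ vertices, $\psi(G)\leq n-1$.
   Context: $d(v,w)$ denotes shortest-path distance. For a graph $G\neq K_1$, vertices $v,w$ are doubly resolved by $x,y$ if $d(v,x)-d(w,x)\neq d(v,y)-d(w,y)$; a set $S\subseteq V(G)$ is doubly resolving if every pair of distinct vertices of $G$ is doubly resolved by two vertices of $S$; $\psi(G)$ is the minimum size of a doubly resolving set of $G$. -}

module Defs where

open import Data.Nat using (ℕ; zero; suc; _≤_)
open import Data.Integer using (ℤ; +_; _-_)
open import Data.Fin using (Fin)
open import Data.Fin.Subset using (Subset; _∈_)
open import Data.Bool using (Bool; true; false)
open import Data.Product using (Σ; ∃; _×_)
open import Relation.Binary.PropositionalEquality using (_≡_; _≢_)

record Graph (n : ℕ) : Set where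
  field
    adj     : Fin n → Fin n → Bool
    adj-sym : ∀ u v → adj u v ≡ adj v u
    adj-irr : ∀ v → adj v v ≡ false
open Graph public

data Walk {n : ℕ} (G : Graph n) : Fin n → Fin n → ℕ → Set where
  nil  : ∀ {v} → Walk G v v zero
  cons : ∀ {v u w k} → adj G v u ≡ true → Walk G u w k → Walk G v w (suc k)

Connected : ∀ {n} → Graph n → Set
Connected G = ∀ v w → ∃ λ k → Walk G v w k

IsDist : ∀ {n} → Graph n → Fin n → Fin n → ℕ → Set
IsDist G v w k = Walk G v w k × (∀ m → Walk G v w m → k ≤ m)

DoublyResolvedBy : ∀ {n} → Graph n → (v w x y : Fin n) → Set
DoublyResolvedBy G v w x y =
  ∀ a b c e → IsDist G v x a → IsDist G w x b → IsDist G v y c → IsDist G w y e →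
  (+ a - + b) ≢ (+ c - + e)

DoublyResolving : ∀ {n} → Graph n → Subset n → Set
DoublyResolving G S =
  ∀ v w → v ≢ w → Σ _ λ x → Σ _ λ y → x ∈ S × y ∈ S × DoublyResolvedBy G v w x y

{-# OPTIONS --safe #-}
module Submission where

-- A connected graph on at least three vertices has a vertex u with two distinct
-- neighbours, and V ∖ {u} is doubly resolving. Two vertices v, w ≠ u are resolved
-- by v and w themselves: d(v,v) − d(w,v) ≤ 0 < d(v,w) − d(w,w). The vertex u and
-- some w ≠ u are resolved by w and a neighbour p ≠ w of u:
-- d(u,p) − d(w,p) ≤ 1 − 1 = 0 < d(u,w) − d(w,w).

open import Defs
open import Data.Nat using (ℕ; _≤_; _<_; _∸_; s≤s; z≤n)
open import Data.Nat.Properties using (n≤0⇒n≡0; ≤-reflexive; ≤-trans)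
open import Data.Integer as ℤ using (+_; _-_; -_; 0ℤ; +≤+; +<+)
open import Data.Integer.Properties using (i≤j⇒i-j≤0; +-monoˡ-<; +-inverseʳ; ≤-<-trans; <⇒≢; +-0-abelianGroup)
import Data.Integer.Properties as ℤₚ
open import Algebra.Properties.AbelianGroup +-0-abelianGroup using (⁻¹-anti-homo-//)
open import Data.Fin using (Fin; _≟_)
import Data.Fin as Fin
open import Data.Fin.Subset using (Subset; ∣_∣; ∁; ⁅_⁆; _∈_)
open import Data.Fin.Subset.Properties using (∣∁p∣≡n∸∣p∣; ∣⁅x⁆∣≡1; x≢y⇒x∉⁅y⁆; x∉p⇒x∈∁p)
open import Data.Product using (Σ; ∃; _×_; _,_; proj₂)
open import Data.Bool using (true)
open import Data.Empty using (⊥-elim)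
open import Function using (_∘_)
open import Relation.Nullary using (yes; no)
open import Relation.Binary.PropositionalEquality
  using (_≡_; _≢_; refl; sym; trans; cong; module ≡-Reasoning)

differences-≢ : ∀ {a b c e} → a ≤ b → e < c → + a - + b ≢ + c - + e
differences-≢ {a} {b} {c} {e} a≤b e<c =
  <⇒≢ (≤-<-trans (i≤j⇒i-j≤0 (+≤+ a≤b)) 0<c-e)
  where
  open ℤₚ.≤-Reasoning
  0<c-e : 0ℤ ℤ.< + c - + e
  0<c-e = begin-strict
    0ℤ        ≡⟨ sym (+-inverseʳ (+ e)) ⟩
    + e - + e <⟨ +-monoˡ-< (- + e) (+<+ e<c) ⟩
    + c - + e ∎

x≢y⇒x∈∁⁅y⁆ : ∀ {n} {x y : Fin n} → x ≢ y → x ∈ ∁ ⁅ y ⁆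
x≢y⇒x∈∁⁅y⁆ = x∉p⇒x∈∁p ∘ x≢y⇒x∉⁅y⁆

module _ {n : ℕ} (G : Graph n) where

  HasTwoNeighbours : Fin n → Set
  HasTwoNeighbours u = Σ (Fin n) λ p → Σ (Fin n) λ q →
    adj G u p ≡ true × adj G u q ≡ true × p ≢ q

  adj⇒≢ : ∀ {u v} → adj G u v ≡ true → u ≢ v
  adj⇒≢ {u} uv refl with trans (sym uv) (adj-irr G u)
  ... | ()

  adj-sym′ : ∀ {u v} → adj G u v ≡ true → adj G v u ≡ true
  adj-sym′ {u} {v} uv = trans (adj-sym G v u) uv

  walk-≢⇒0< : ∀ {v w k} → v ≢ w → Walk G v w k → 0 < k
  walk-≢⇒0< v≢w nil        = ⊥-elim (v≢w refl)
  walk-≢⇒0< v≢w (cons _ _) = s≤s z≤n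

  walk-≢⇒∃adj : ∀ {v w k} → v ≢ w → Walk G v w k → ∃ λ u → adj G v u ≡ true
  walk-≢⇒∃adj v≢w nil         = ⊥-elim (v≢w refl)
  walk-≢⇒∃adj v≢w (cons vu _) = _ , vu

  isDist-refl⇒≡0 : ∀ {v a} → IsDist G v v a → a ≡ 0
  isDist-refl⇒≡0 (_ , shortest) = n≤0⇒n≡0 (shortest 0 nil)

  isDist-≢⇒0< : ∀ {v w a} → v ≢ w → IsDist G v w a → 0 < a
  isDist-≢⇒0< v≢w (walk , _) = walk-≢⇒0< v≢w walk

  isDist-adj⇒≤1 : ∀ {v w a} → adj G v w ≡ true → IsDist G v w a → a ≤ 1
  isDist-adj⇒≤1 vw (_ , shortest) = shortest 1 (cons vw nil)

  -- The first step of the walk into {o, a} ends at a vertex adjacent both to the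
  -- vertex it came from and to the other end of the edge, and these are distinct.
  walk-into-edge⇒∃twoNeighbours : ∀ {o a c k} → adj G o a ≡ true → c ≢ o → c ≢ a →
    Walk G c a k → ∃ HasTwoNeighbours
  walk-into-edge⇒∃twoNeighbours oa c≢o c≢a nil = ⊥-elim (c≢a refl)
  walk-into-edge⇒∃twoNeighbours {o} {a} {c} oa c≢o c≢a (cons {u = x} cx walk)
    with x ≟ a | x ≟ o
  ... | yes refl | _        = a , o , c , adj-sym′ oa , adj-sym′ cx , c≢o ∘ sym
  ... | no _     | yes refl = o , c , a , adj-sym′ cx , oa , c≢a
  ... | no x≢a   | no x≢o   = walk-into-edge⇒∃twoNeighbours oa x≢o x≢a walk

  neighbour-avoiding : ∀ {u} → HasTwoNeighbours u → ∀ w →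
    ∃ λ p → adj G u p ≡ true × p ≢ w
  neighbour-avoiding (p , q , up , uq , p≢q) w with p ≟ w
  ... | yes refl = q , uq , p≢q ∘ sym
  ... | no p≢w   = p , up , p≢w

  doublyResolvedBy-swap : ∀ {v w x y} → DoublyResolvedBy G v w x y → DoublyResolvedBy G w v x y
  doublyResolvedBy-swap resolved a b c e da db dc de a-b≡c-e =
    resolved b a e c db da de dc (begin
      + b - + a     ≡⟨ sym (⁻¹-anti-homo-// (+ a) (+ b)) ⟩
      - (+ a - + b) ≡⟨ cong -_ a-b≡c-e ⟩
      - (+ c - + e) ≡⟨ ⁻¹-anti-homo-// (+ c) (+ e) ⟩
      + e - + c     ∎)
    where open ≡-Reasoning

  doublyResolvedBy-self : ∀ {v w} → v ≢ w → DoublyResolvedBy G v w v w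
  doublyResolvedBy-self v≢w a b c e da _ dc de
    rewrite isDist-refl⇒≡0 da | isDist-refl⇒≡0 de =
    differences-≢ {b = b} {c = c} z≤n (isDist-≢⇒0< v≢w dc)

  doublyResolvedBy-neighbour : ∀ {v w p} → adj G v p ≡ true → v ≢ w → p ≢ w →
    DoublyResolvedBy G v w w p
  doublyResolvedBy-neighbour vp v≢w p≢w a b c e da db dc de
    rewrite isDist-refl⇒≡0 db =
    differences-≢ (≤-trans (isDist-adj⇒≤1 vp dc) (isDist-≢⇒0< (p≢w ∘ sym) de))
                  (isDist-≢⇒0< v≢w da) ∘ sym

  ∁⁅u⁆-doublyResolving : ∀ {u} → HasTwoNeighbours u → DoublyResolving G (∁ ⁅ u ⁆)
  ∁⁅u⁆-doublyResolving {u} two v w v≢w with v ≟ u | w ≟ u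
  ... | yes refl | yes refl = ⊥-elim (v≢w refl)
  ... | no v≢u   | no w≢u   = v , w , x≢y⇒x∈∁⁅y⁆ v≢u , x≢y⇒x∈∁⁅y⁆ w≢u , doublyResolvedBy-self v≢w
  ... | yes refl | no w≢u   with neighbour-avoiding two w
  ...   | p , up , p≢w = w , p , x≢y⇒x∈∁⁅y⁆ w≢u , x≢y⇒x∈∁⁅y⁆ (adj⇒≢ up ∘ sym) ,
          doublyResolvedBy-neighbour up v≢w p≢w
  ∁⁅u⁆-doublyResolving {u} two v w v≢w | no v≢u | yes refl with neighbour-avoiding two v
  ...   | p , up , p≢v = v , p , x≢y⇒x∈∁⁅y⁆ v≢u , x≢y⇒x∈∁⁅y⁆ (adj⇒≢ up ∘ sym) ,
          doublyResolvedBy-swap (doublyResolvedBy-neighbour up (v≢w ∘ sym) p≢v)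

connected⇒∃twoNeighbours : ∀ {n} → 3 ≤ n → (G : Graph n) → Connected G → ∃ (HasTwoNeighbours G)
connected⇒∃twoNeighbours (s≤s (s≤s (s≤s _))) G connected =
  from-edge (walk-≢⇒∃adj G (λ ()) (connected v₀ v₁ .proj₂))
  where
  v₀ v₁ v₂ : Fin _
  v₀ = Fin.zero
  v₁ = Fin.suc Fin.zero
  v₂ = Fin.suc (Fin.suc Fin.zero)
  from-edge : (∃ λ a → adj G v₀ a ≡ true) → ∃ (HasTwoNeighbours G)
  from-edge (a , v₀a) with a ≟ v₁
  ... | yes refl = walk-into-edge⇒∃twoNeighbours G v₀a (λ ()) (λ ()) (connected v₂ v₁ .proj₂)
  ... | no a≢v₁  = walk-into-edge⇒∃twoNeighbours G v₀a (λ ()) (a≢v₁ ∘ sym) (connected v₁ a .proj₂)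

∣∁⁅x⁆∣≡n∸1 : ∀ {n} (x : Fin n) → ∣ ∁ ⁅ x ⁆ ∣ ≡ n ∸ 1
∣∁⁅x⁆∣≡n∸1 {n} x = trans (∣∁p∣≡n∸∣p∣ ⁅ x ⁆) (cong (n ∸_) (∣⁅x⁆∣≡1 x))

lemma4p3 : ∀ (n : ℕ) → 3 ≤ n → (G : Graph n) → Connected G →
    Σ (Subset n) λ S → DoublyResolving G S × ∣ S ∣ ≤ n ∸ 1
lemma4p3 n 3≤n G connected with connected⇒∃twoNeighbours 3≤n G connected
... | u , two = ∁ ⁅ u ⁆ , ∁⁅u⁆-doublyResolving G two , ≤-reflexive (∣∁⁅x⁆∣≡n∸1 u)
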